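{- Let $(A_1,B_1,C_1),(A_2,B_2,C_2)\in\mathcal{S}_n(\mathbb{Z})$ and set $\alpha_j=B_j+C_j\omega$. Let $\mathfrak{d}=(\alpha_1)+(\alpha_2')$ be the ideal generated by $\alpha_1$ and the conjugate $\alpha_2'$ of $\alpha_2$. Then $\mathfrak{d}=\mathfrak{e}^n$ for some ideal $\mathfrak{e}$ of $\mathcal{O}$, and with $e=N(\mathfrak{e})$ we have $$\gcd(B_1B_2+mC_1C_2,\ B_1C_2+B_2C_1+\sigma C_1C_2)=e^n.$$ Conversely, the gcd on the left hand side is the $n$-th power $e^n$ of a positive integer $e$, and in that case $(\alpha_1)+(\alpha_2')=\mathfrak{e}^n$ for an ideal $\mathfrak{e}$ with $N(\mathfrak{e})=e$.
   Context: $\Delta$ is a fundamental discriminant, written $\Delta=4m+\sigma$ with $\sigma\in\{0,1\}$; $K=\mathbb{Q}(\sqrt{\Delta})$ with ring of integers $\mathcal{O}=\mathbb{Z}[\omega]$, $\omega=(\sigma+\sqrt{\Delta})/2$; $Q_0(x,y)=x^2+\sigma xy-my^2=N(x+y\omega)$. For a fixed integer $n\ge2$, $\mathcal{S}_n(\mathbb{Z})$ is the set of integer triples $(A,B,C)$ with $Q_0(B,C)=A^n$ and $\gcd(B,C)=1$. $N(\mathfrak{e})$ denotes the absolute norm of an ideal. -}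

module Defs where

open import Level using (Level; suc; zero)
open import Data.Unit using (⊤)
open import Data.Nat as ℕ using (ℕ)
open import Data.Nat.Divisibility as ℕD using ()
open import Data.Nat.GCD using (gcd)
open import Data.Integer using (ℤ; +_; _+_; _-_; _*_; -_; ∣_∣; _^_)
open import Data.Product using (Σ; ∃; ∃-syntax; _×_; _,_)
open import Data.Sum using (_⊎_)
open import Relation.Binary.PropositionalEquality using (_≡_; _≢_)

-- Elements x + y ω of 𝒪 = ℤ[ω] are represented by their coordinates (x , y).
Elt : Set
Elt = ℤ × ℤ

disc : ℤ → ℤ → ℤ
disc m σ = + 4 * m + σ

SquareFree : ℤ → Set
SquareFree x = ∀ (d : ℕ) → (d ℕ.* d) ℕD.∣ ∣ x ∣ → d ≡ 1

IsFundamental : ℤ → Set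
IsFundamental Δ =
  Δ ≢ + 1 ×
  ( ((∃[ t ] Δ ≡ + 4 * t + + 1) × SquareFree Δ)
  ⊎ (∃[ k ] (Δ ≡ + 4 * k × ((∃[ t ] k ≡ + 4 * t + + 2) ⊎ (∃[ t ] k ≡ + 4 * t + + 3)) × SquareFree k)))

-- Arithmetic of 𝒪, with ω² = σ ω + m.
module _ (m σ : ℤ) where

  _⊕_ : Elt → Elt → Elt
  (a , b) ⊕ (c , d) = (a + c , b + d)

  _⊗_ : Elt → Elt → Elt
  (a , b) ⊗ (c , d) = (a * c + m * b * d , a * d + b * c + σ * b * d)

  -- Galois conjugate: ω' = σ - ω
  conj : Elt → Elt
  conj (a , b) = (a + σ * b , - b)

  -- Q₀(x,y) = x² + σxy - my² = N(x + yω)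
  Q₀ : ℤ → ℤ → ℤ
  Q₀ x y = x * x + σ * x * y - m * y * y

  InS : ℕ → ℤ → ℤ → ℤ → Set
  InS n A B C = Q₀ B C ≡ A ^ n × gcd ∣ B ∣ ∣ C ∣ ≡ 1

  record IsIdeal (I : Elt → Set) : Set where
    field
      has-zero : I (+ 0 , + 0)
      closed-+ : ∀ {x y} → I x → I y → I (x ⊕ y)
      closed-* : ∀ r {x} → I x → I (r ⊗ x)

  Gen₂ : Elt → Elt → Elt → Set
  Gen₂ a b x = ∃[ r ] ∃[ s ] x ≡ (r ⊗ a) ⊕ (s ⊗ b)

  data Prod (I J : Elt → Set) : Elt → Set where
    pzero : Prod I J (+ 0 , + 0)
    pgen  : ∀ {a b} → I a → J b → Prod I J (a ⊗ b)
    padd  : ∀ {x y} → Prod I J x → Prod I J y → Prod I J (x ⊕ y)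

  Pow : (Elt → Set) → ℕ → Elt → Set
  Pow I ℕ.zero    = λ _ → ⊤
  Pow I (ℕ.suc k) = Prod I (Pow I k)

  -- absolute norm N(I) = [𝒪 : I] = |det| of a ℤ-basis of I (w.r.t. 1, ω)
  HasNorm : (Elt → Set) → ℕ → Set
  HasNorm I e =
    Σ Elt λ v → Σ Elt λ w →
      I v × I w ×
      (∀ x → I x → ∃[ p ] ∃[ q ] x ≡ ((p , + 0) ⊗ v) ⊕ ((q , + 0) ⊗ w)) ×
      ∣ Data.Product.proj₁ v * Data.Product.proj₂ w - Data.Product.proj₂ v * Data.Product.proj₁ w ∣ ≡ e

_≐_ : (Elt → Set) → (Elt → Set) → Set
I ≐ J = (∀ x → I x → J x) × (∀ x → J x → I x)

{-# OPTIONS --safe #-}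
-- Write αⱼ = Bⱼ + Cⱼ ω, so that N(αⱼ) = Aⱼⁿ =: Nⱼ.  As Nⱼ is prime to Cⱼ, αⱼ ≡ Cⱼ (x + ω) modulo Nⱼ
-- for an integer x with Nⱼ ∣ f x = N(x + ω); let x belong to α₁, y to ᾱ₂, and e = gcd(A₁, A₂, x - y).
-- Since Δ is fundamental and n ≥ 2, A₁ is prime to 2x + σ, and f x - f y = (x + y + σ)(x - y) then
-- gives eⁿ ∣ x - y.  Hence α₁ and ᾱ₂ lie in the lattice ⟨ eⁿ , x +ω⟩ = eⁿℤ + (x + ω)ℤ, while eⁿ (a
-- ℤ-combination of N₁, N₂ and (x - y)ⁿ) and x + ω lie in (α₁, ᾱ₂); so (α₁, ᾱ₂) = ⟨ eⁿ , x +ω⟩, which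
-- is ⟨ e , x +ω⟩ⁿ, again because e is prime to 2x + σ.  Finally the gcd g of the coordinates of
-- α₁ α₂ = α₁ · conj(ᾱ₂) divides N₁ and N₂ (multiply by ᾱ₁, resp. ᾱ₂, and use Bⱼ ⊥ Cⱼ), hence x - y and
-- eⁿ; and reducing α₁ α₂ modulo ⟨ eⁿ , x +ω⟩ shows eⁿ ∣ g.
module Submission where

open import Defs
open import Data.Nat using (ℕ; zero; suc; _≤_; _<_; _^_; s≤s)
import Data.Nat as ℕ
import Data.Nat.Properties as ℕᵖ
import Data.Nat.Divisibility as ℕᵈ
open import Data.Nat.GCD using (gcd; gcd-GCD; gcd[m,n]∣m; gcd[m,n]∣n; gcd[m,n]≡0⇒m≡0; gcd-greatest; module Bézout)
open import Data.Integer using (ℤ; +_; -[1+_]; _+_; _-_; -_; _*_; ∣_∣; 0ℤ; 1ℤ) renaming (_^_ to _^ℤ_)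
import Data.Integer.Properties as ℤ
open import Data.Integer.Divisibility.Signed
open import Data.Integer.Tactic.RingSolver using (solve-∀)
open import Data.Product using (Σ; ∃₂; ∃-syntax; _×_; _,_; proj₁; proj₂)
open import Data.Sum using (_⊎_; inj₁; inj₂)
open import Data.Integer.DivMod using (_/ℕ_; _%ℕ_; n%ℕd<d; a≡a%ℕn+[a/ℕn]*n)
open import Data.Unit using (tt)
open import Relation.Binary.Definitions using (tri<; tri≈; tri>)
open import Relation.Nullary.Decidable using (False; toWitnessFalse)
open import Function using (_∘_)
open import Data.Empty using (⊥; ⊥-elim)
open import Relation.Binary.PropositionalEquality
  using (_≡_; _≢_; refl; sym; trans; cong; cong₂; subst; module ≡-Reasoning)

-- Integer divisibility and coprimality

∣-*-∣ : ∀ {a b c d} → a ∣ b → c ∣ d → a * c ∣ b * d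
∣-*-∣ {a} {d = d} a∣b c∣d = ∣-trans (*-monoʳ-∣ a c∣d) (*-monoˡ-∣ d a∣b)

^-monoˡ-∣ : ∀ {a b} k → a ∣ b → a ^ℤ k ∣ b ^ℤ k
^-monoˡ-∣ zero    _   = ∣-refl
^-monoˡ-∣ (suc k) a∣b = ∣-*-∣ a∣b (^-monoˡ-∣ k a∣b)

i∣i^n : ∀ i {n} → 1 ≤ n → i ∣ i ^ℤ n
i∣i^n i {suc n} _ = ∣m⇒∣m*n (i ^ℤ n) ∣-refl

i^n∣i^[1+n] : ∀ i n → i ^ℤ n ∣ i ^ℤ suc n
i^n∣i^[1+n] i n = ∣n⇒∣m*n i ∣-refl

h∣i⇒h*h∣i^n : ∀ {h i} n → 2 ≤ n → h ∣ i → h * h ∣ i ^ℤ n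
h∣i⇒h*h∣i^n (suc zero) (s≤s ()) _
h∣i⇒h*h∣i^n {i = i} (suc (suc n)) _ h∣i = ∣-*-∣ h∣i (∣m⇒∣m*n (i ^ℤ n) h∣i)

^-distribʳ-* : ∀ a b k → (a * b) ^ℤ k ≡ a ^ℤ k * b ^ℤ k
^-distribʳ-* a b zero    = refl
^-distribʳ-* a b (suc k) = begin
  a * b * (a * b) ^ℤ k         ≡⟨ cong (a * b *_) (^-distribʳ-* a b k) ⟩
  a * b * (a ^ℤ k * b ^ℤ k)    ≡⟨ lemma a b (a ^ℤ k) (b ^ℤ k) ⟩
  a * a ^ℤ k * (b * b ^ℤ k)    ∎
  where
  open ≡-Reasoning
  lemma : ∀ a b p q → a * b * (p * q) ≡ a * p * (b * q)
  lemma = solve-∀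

^-cancelʳ-≡ : ∀ {a b} n → 1 ≤ n → a ^ n ≡ b ^ n → a ≡ b
^-cancelʳ-≡ {a} {b} n@(suc _) _ aⁿ≡bⁿ with ℕᵖ.<-cmp a b
... | tri< a<b _ _ = ⊥-elim (ℕᵖ.<-irrefl aⁿ≡bⁿ (ℕᵖ.^-monoˡ-< n a<b))
... | tri≈ _ a≡b _ = a≡b
... | tri> _ _ a>b = ⊥-elim (ℕᵖ.<-irrefl (sym aⁿ≡bⁿ) (ℕᵖ.^-monoˡ-< n a>b))

pos-^ : ∀ e k → (+ e) ^ℤ k ≡ + (e ^ k)
pos-^ e zero    = refl
pos-^ e (suc k) = trans (cong (+ e *_) (pos-^ e k)) (sym (ℤ.pos-* e (e ^ k)))

-- Coprimality in Bézout form: this is what the ideal-membership arguments consume.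
Coprime : ℤ → ℤ → Set
Coprime a b = ∃₂ λ s t → s * a + t * b ≡ 1ℤ

coprime-sym : ∀ {a b} → Coprime a b → Coprime b a
coprime-sym {a} {b} (s , t , eq) = t , s , trans (ℤ.+-comm (t * b) (s * a)) eq

bézout-scale : ∀ {s p t q} w → s * p + t * q ≡ 1ℤ → s * (p * w) + t * (q * w) ≡ w
bézout-scale {s} {p} {t} {q} w st = begin
  s * (p * w) + t * (q * w) ≡⟨ lemma s p t q w ⟩
  (s * p + t * q) * w       ≡⟨ cong (_* w) st ⟩
  1ℤ * w                    ≡⟨ ℤ.*-identityˡ w ⟩
  w                         ∎
  where
  open ≡-Reasoning
  lemma : ∀ s p t q w → s * (p * w) + t * (q * w) ≡ (s * p + t * q) * w
  lemma = solve-∀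

coprime-∣-multiples : ∀ {d p q w} → Coprime p q → d ∣ p * w → d ∣ q * w → d ∣ w
coprime-∣-multiples {d} {p} {q} {w} (s , t , st) d∣pw d∣qw =
  subst (d ∣_) (bézout-scale {s} {p} {t} {q} w st) (∣m∣n⇒∣m+n (∣n⇒∣m*n s d∣pw) (∣n⇒∣m*n t d∣qw))

coprime-divisor : ∀ {a b c} → Coprime a b → a ∣ b * c → a ∣ c
coprime-divisor {c = c} a⊥b = coprime-∣-multiples a⊥b (∣m⇒∣m*n c ∣-refl)

coprime-∣ˡ : ∀ {a b d} → d ∣ a → Coprime a b → Coprime d b
coprime-∣ˡ {b = b} {d} (divides q refl) (s , t , eq) =
  s * q , t , trans (cong (_+ t * b) (ℤ.*-assoc s q d)) eq

coprime-*ˡ : ∀ {a b c} → Coprime a c → Coprime b c → Coprime (a * b) c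
coprime-*ˡ {a} {b} {c} (s , t , eq) (s′ , t′ , eq′) =
  s * s′ , s * a * t′ + t * s′ * b + t * t′ * c ,
  trans (lemma s a t c s′ b t′) (cong₂ _*_ eq eq′)
  where
  lemma : ∀ s a t c s′ b t′ →
    s * s′ * (a * b) + (s * a * t′ + t * s′ * b + t * t′ * c) * c ≡ (s * a + t * c) * (s′ * b + t′ * c)
  lemma = solve-∀

coprime-^ˡ : ∀ {a c} k → Coprime a c → Coprime (a ^ℤ k) c
coprime-^ˡ {c = c} zero    _ = 1ℤ , 0ℤ , cong (λ r → 1ℤ + r) (ℤ.*-zeroˡ c)
coprime-^ˡ         (suc k) h = coprime-*ˡ h (coprime-^ˡ k h)

coprime-resp-∣- : ∀ {a b b′} → a ∣ b - b′ → Coprime a b → Coprime a b′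
coprime-resp-∣- {a} {b} {b′} (divides q eq) (s , t , st) = s + t * q , t , (begin
  (s + t * q) * a + t * b′   ≡⟨ lemma s t q a b′ ⟩
  s * a + t * (b′ + q * a)   ≡⟨ cong (λ r → s * a + t * (b′ + r)) (sym eq) ⟩
  s * a + t * (b′ + (b - b′)) ≡⟨ cong (λ r → s * a + t * r) (lemma′ b b′) ⟩
  s * a + t * b              ≡⟨ st ⟩
  1ℤ                         ∎)
  where
  open ≡-Reasoning
  lemma : ∀ s t q a b′ → (s + t * q) * a + t * b′ ≡ s * a + t * (b′ + q * a)
  lemma = solve-∀
  lemma′ : ∀ b b′ → b′ + (b - b′) ≡ b
  lemma′ = solve-∀

pos-bézout : ∀ g y n x m → g ℕ.+ y ℕ.* n ≡ x ℕ.* m → + g ≡ + x * + m + - + y * + n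
pos-bézout g y n x m eq = begin
  + g                            ≡⟨ lemma (+ g) (+ y) (+ n) ⟩
  + g + + y * + n + - + y * + n  ≡⟨ cong (λ r → r + - + y * + n) embedded ⟩
  + x * + m + - + y * + n        ∎
  where
  open ≡-Reasoning
  lemma : ∀ g y n → g ≡ g + y * n + - y * n
  lemma = solve-∀
  embedded : + g + + y * + n ≡ + x * + m
  embedded = trans (sym (trans (ℤ.pos-+ g (y ℕ.* n)) (cong (λ r → + g + r) (ℤ.pos-* y n))))
                   (trans (cong +_ eq) (ℤ.pos-* x m))

bézoutℕ : ∀ m n → ∃₂ λ s t → s * + m + t * + n ≡ + gcd m n
bézoutℕ m n with Bézout.identity (gcd-GCD m n)
... | Bézout.+- x y eq = + x , - + y , sym (pos-bézout (gcd m n) y n x m eq)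
... | Bézout.-+ x y eq = - + x , + y , sym (trans (pos-bézout (gcd m n) x m y n eq) (ℤ.+-comm (+ y * + n) (- + x * + m)))

abs-as-multiple : ∀ a → Σ ℤ λ ε → + ∣ a ∣ ≡ ε * a
abs-as-multiple a with ℤ.+∣i∣≡i⊎+∣i∣≡-i a
... | inj₁ eq = 1ℤ , trans eq (sym (ℤ.*-identityˡ a))
... | inj₂ eq = - 1ℤ , trans eq (sym (ℤ.-1*i≡-i a))

bézout : ∀ a b → ∃₂ λ s t → s * a + t * b ≡ + gcd ∣ a ∣ ∣ b ∣
bézout a b with abs-as-multiple a | abs-as-multiple b | bézoutℕ ∣ a ∣ ∣ b ∣
... | ε , εa | δ , δb | s , t , st =
  s * ε , t * δ , trans (lemma s ε a t δ b) (trans (sym (cong₂ (λ u v → s * u + t * v) εa δb)) st)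
  where
  lemma : ∀ s ε a t δ b → s * ε * a + t * δ * b ≡ s * (ε * a) + t * (δ * b)
  lemma = solve-∀

gcd≡1⇒coprime : ∀ a b → gcd ∣ a ∣ ∣ b ∣ ≡ 1 → Coprime a b
gcd≡1⇒coprime a b gcd≡1 = let s , t , st = bézout a b in s , t , trans st (cong +_ gcd≡1)

coprime-^ : ∀ {a b} k → Coprime a b → Coprime (a ^ℤ k) (b ^ℤ k)
coprime-^ k a⊥b = coprime-sym (coprime-^ˡ k (coprime-sym (coprime-^ˡ k a⊥b)))

scaled-bézout-^ : ∀ {a b} h k → Coprime a b → ∃₂ λ s t → s * (a * h) ^ℤ k + t * (b * h) ^ℤ k ≡ h ^ℤ k
scaled-bézout-^ {a} {b} h k a⊥b with coprime-^ k a⊥b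
... | s , t , st = s , t , (begin
  s * (a * h) ^ℤ k + t * (b * h) ^ℤ k            ≡⟨ cong₂ (λ u v → s * u + t * v) (^-distribʳ-* a h k) (^-distribʳ-* b h k) ⟩
  s * (a ^ℤ k * h ^ℤ k) + t * (b ^ℤ k * h ^ℤ k)  ≡⟨ lemma s (a ^ℤ k) t (b ^ℤ k) (h ^ℤ k) ⟩
  (s * a ^ℤ k + t * b ^ℤ k) * h ^ℤ k             ≡⟨ cong (_* h ^ℤ k) st ⟩
  1ℤ * h ^ℤ k                                    ≡⟨ ℤ.*-identityˡ (h ^ℤ k) ⟩
  h ^ℤ k                                         ∎)
  where
  open ≡-Reasoning
  lemma : ∀ s p t q r → s * (p * r) + t * (q * r) ≡ (s * p + t * q) * r
  lemma = solve-∀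

-- Dividing s a + t b = h through by a nonzero common divisor h leaves coprime cofactors.
common-divisor-bézout-^ : ∀ {a b s t} h k → + suc h ∣ a → + suc h ∣ b → s * a + t * b ≡ + suc h →
  ∃₂ λ s′ t′ → s′ * a ^ℤ k + t′ * b ^ℤ k ≡ (+ suc h) ^ℤ k
common-divisor-bézout-^ {s = s} {t} h k (divides a′ refl) (divides b′ refl) st =
  scaled-bézout-^ H k (s , t , ℤ.*-cancelʳ-≡ _ _ H (trans (sym (lemma s a′ t b′ H)) (trans st (sym (ℤ.*-identityˡ H)))))
  where
  H = + suc h
  lemma : ∀ s a t b h → s * (a * h) + t * (b * h) ≡ (s * a + t * b) * h
  lemma = solve-∀

gcd-^-bézout : ∀ a b k → ∃₂ λ s t → s * a ^ℤ k + t * b ^ℤ k ≡ (+ gcd ∣ a ∣ ∣ b ∣) ^ℤ k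
gcd-^-bézout a b k = via (gcd ∣ a ∣ ∣ b ∣) refl
  where
  via : ∀ h → gcd ∣ a ∣ ∣ b ∣ ≡ h → ∃₂ λ s t → s * a ^ℤ k + t * b ^ℤ k ≡ (+ h) ^ℤ k
  via zero g≡0 = 1ℤ , 0ℤ , trans (lemma (a ^ℤ k) (b ^ℤ k)) (cong (_^ℤ k) (ℤ.∣i∣≡0⇒i≡0 (gcd[m,n]≡0⇒m≡0 g≡0)))
    where
    lemma : ∀ p q → 1ℤ * p + 0ℤ * q ≡ p
    lemma = solve-∀
  via (suc h) g≡h =
    let s , t , st = bézout a b in
    common-divisor-bézout-^ {s = s} {t} h k (h∣ (gcd[m,n]∣m ∣ a ∣ ∣ b ∣)) (h∣ (gcd[m,n]∣n ∣ a ∣ ∣ b ∣)) (trans st (cong +_ g≡h))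
    where
    h∣ : ∀ {c} → gcd ∣ a ∣ ∣ b ∣ ℕᵈ.∣ ∣ c ∣ → + suc h ∣ c
    h∣ g∣c = ∣ᵤ⇒∣ (subst (ℕᵈ._∣ _) g≡h g∣c)

∣-gcd-^ : ∀ {c} a b k → c ∣ a ^ℤ k → c ∣ b ^ℤ k → c ∣ (+ gcd ∣ a ∣ ∣ b ∣) ^ℤ k
∣-gcd-^ {c} a b k c∣aᵏ c∣bᵏ = let s , t , st = gcd-^-bézout a b k in subst (c ∣_) st (∣m∣n⇒∣m+n (∣n⇒∣m*n s c∣aᵏ) (∣n⇒∣m*n t c∣bᵏ))

-- The order ℤ[ω] and its ideals

_⊆_ : (Elt → Set) → (Elt → Set) → Set
I ⊆ J = ∀ z → I z → J z

≐-sym : ∀ {I J} → I ≐ J → J ≐ I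
≐-sym (I⊆J , J⊆I) = J⊆I , I⊆J

≐-trans : ∀ {I J K} → I ≐ J → J ≐ K → I ≐ K
≐-trans (I⊆J , J⊆I) (J⊆K , K⊆J) = (λ z → J⊆K z ∘ I⊆J z) , (λ z → J⊆I z ∘ K⊆J z)

module Quadratic (m σ : ℤ) where

  infixl 7 _⊛_
  infixl 6 _⊞_

  _⊛_ : Elt → Elt → Elt
  _⊛_ = _⊗_ m σ

  _⊞_ : Elt → Elt → Elt
  _⊞_ = _⊕_ m σ

  ⊛-comm : ∀ a b → a ⊛ b ≡ b ⊛ a
  ⊛-comm (a₁ , a₂) (b₁ , b₂) = cong₂ _,_ (lemma₁ a₁ a₂ b₁ b₂ m) (lemma₂ a₁ a₂ b₁ b₂ σ)
    where
    lemma₁ : ∀ a₁ a₂ b₁ b₂ m → a₁ * b₁ + m * a₂ * b₂ ≡ b₁ * a₁ + m * b₂ * a₂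
    lemma₁ = solve-∀
    lemma₂ : ∀ a₁ a₂ b₁ b₂ σ → a₁ * b₂ + a₂ * b₁ + σ * a₂ * b₂ ≡ b₁ * a₂ + b₂ * a₁ + σ * b₂ * a₂
    lemma₂ = solve-∀

  ⊛-assoc : ∀ a b c → a ⊛ b ⊛ c ≡ a ⊛ (b ⊛ c)
  ⊛-assoc (a₁ , a₂) (b₁ , b₂) (c₁ , c₂) = cong₂ _,_ (lemma₁ a₁ a₂ b₁ b₂ c₁ c₂ m σ) (lemma₂ a₁ a₂ b₁ b₂ c₁ c₂ m σ)
    where
    lemma₁ : ∀ a₁ a₂ b₁ b₂ c₁ c₂ m σ →
      (a₁ * b₁ + m * a₂ * b₂) * c₁ + m * (a₁ * b₂ + a₂ * b₁ + σ * a₂ * b₂) * c₂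
      ≡ a₁ * (b₁ * c₁ + m * b₂ * c₂) + m * a₂ * (b₁ * c₂ + b₂ * c₁ + σ * b₂ * c₂)
    lemma₁ = solve-∀
    lemma₂ : ∀ a₁ a₂ b₁ b₂ c₁ c₂ m σ →
      (a₁ * b₁ + m * a₂ * b₂) * c₂ + (a₁ * b₂ + a₂ * b₁ + σ * a₂ * b₂) * c₁ + σ * (a₁ * b₂ + a₂ * b₁ + σ * a₂ * b₂) * c₂
      ≡ a₁ * (b₁ * c₂ + b₂ * c₁ + σ * b₂ * c₂) + a₂ * (b₁ * c₁ + m * b₂ * c₂) + σ * a₂ * (b₁ * c₂ + b₂ * c₁ + σ * b₂ * c₂)
    lemma₂ = solve-∀

  ⊛-distribˡ-⊞ : ∀ a b c → a ⊛ (b ⊞ c) ≡ a ⊛ b ⊞ a ⊛ c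
  ⊛-distribˡ-⊞ (a₁ , a₂) (b₁ , b₂) (c₁ , c₂) = cong₂ _,_ (lemma₁ a₁ a₂ b₁ b₂ c₁ c₂ m) (lemma₂ a₁ a₂ b₁ b₂ c₁ c₂ σ)
    where
    lemma₁ : ∀ a₁ a₂ b₁ b₂ c₁ c₂ m → a₁ * (b₁ + c₁) + m * a₂ * (b₂ + c₂) ≡ a₁ * b₁ + m * a₂ * b₂ + (a₁ * c₁ + m * a₂ * c₂)
    lemma₁ = solve-∀
    lemma₂ : ∀ a₁ a₂ b₁ b₂ c₁ c₂ σ →
      a₁ * (b₂ + c₂) + a₂ * (b₁ + c₁) + σ * a₂ * (b₂ + c₂) ≡ a₁ * b₂ + a₂ * b₁ + σ * a₂ * b₂ + (a₁ * c₂ + a₂ * c₁ + σ * a₂ * c₂)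
    lemma₂ = solve-∀

  ⊛-zeroʳ : ∀ a → a ⊛ (0ℤ , 0ℤ) ≡ (0ℤ , 0ℤ)
  ⊛-zeroʳ (a₁ , a₂) = cong₂ _,_ (lemma₁ a₁ a₂ m) (lemma₂ a₁ a₂ σ)
    where
    lemma₁ : ∀ a₁ a₂ m → a₁ * 0ℤ + m * a₂ * 0ℤ ≡ 0ℤ
    lemma₁ = solve-∀
    lemma₂ : ∀ a₁ a₂ σ → a₁ * 0ℤ + a₂ * 0ℤ + σ * a₂ * 0ℤ ≡ 0ℤ
    lemma₂ = solve-∀

  ⊞-interchange : ∀ a b c d → (a ⊞ b) ⊞ (c ⊞ d) ≡ (a ⊞ c) ⊞ (b ⊞ d)
  ⊞-interchange (a₁ , a₂) (b₁ , b₂) (c₁ , c₂) (d₁ , d₂) = cong₂ _,_ (lemma a₁ b₁ c₁ d₁) (lemma a₂ b₂ c₂ d₂)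
    where
    lemma : ∀ a b c d → (a + b) + (c + d) ≡ (a + c) + (b + d)
    lemma = solve-∀

  scalar-⊛ : ∀ c z → (c , 0ℤ) ⊛ z ≡ (c * proj₁ z , c * proj₂ z)
  scalar-⊛ c (z₁ , z₂) = cong₂ _,_ (lemma₁ c z₁ z₂ m) (lemma₂ c z₁ z₂ σ)
    where
    lemma₁ : ∀ c z₁ z₂ m → c * z₁ + m * 0ℤ * z₂ ≡ c * z₁
    lemma₁ = solve-∀
    lemma₂ : ∀ c z₁ z₂ σ → c * z₂ + 0ℤ * z₁ + σ * 0ℤ * z₂ ≡ c * z₂
    lemma₂ = solve-∀

  ∈-⊛⊞⊛ : ∀ {I} → IsIdeal m σ I → ∀ {u v} → I u → I v → ∀ r s → I (r ⊛ u ⊞ s ⊛ v)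
  ∈-⊛⊞⊛ I-ideal u∈ v∈ r s = closed-+ (closed-* r u∈) (closed-* s v∈)
    where open IsIdeal I-ideal

  ∈-ℤ-combination : ∀ {I} → IsIdeal m σ I → ∀ {a b} → I (a , 0ℤ) → I (b , 0ℤ) → ∀ s t → I (s * a + t * b , 0ℤ)
  ∈-ℤ-combination {I} I-ideal {a} {b} a∈ b∈ s t =
    subst I (trans (cong₂ _⊞_ (scalar-⊛ s (a , 0ℤ)) (scalar-⊛ t (b , 0ℤ))) (cong (s * a + t * b ,_) (lemma s t)))
      (∈-⊛⊞⊛ I-ideal a∈ b∈ (s , 0ℤ) (t , 0ℤ))
    where
    lemma : ∀ s t → s * 0ℤ + t * 0ℤ ≡ 0ℤ
    lemma = solve-∀

  ∈-ℤ-^ : ∀ {I} → IsIdeal m σ I → ∀ {a} k → 1 ≤ k → I (a , 0ℤ) → I (a ^ℤ k , 0ℤ)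
  ∈-ℤ-^ {I} I-ideal {a} (suc k) _ a∈ =
    subst I (trans (scalar-⊛ (a ^ℤ k) (a , 0ℤ)) (cong₂ _,_ (ℤ.*-comm (a ^ℤ k) a) (ℤ.*-zeroʳ (a ^ℤ k))))
      (IsIdeal.closed-* I-ideal (a ^ℤ k , 0ℤ) a∈)

  ∈-gcd-^ : ∀ {I} → IsIdeal m σ I → ∀ a b k → I (a ^ℤ k , 0ℤ) → I (b ^ℤ k , 0ℤ) → I ((+ gcd ∣ a ∣ ∣ b ∣) ^ℤ k , 0ℤ)
  ∈-gcd-^ {I} I-ideal a b k aᵏ∈ bᵏ∈ = let s , t , st = gcd-^-bézout a b k in subst I (cong (_, 0ℤ) st) (∈-ℤ-combination I-ideal aᵏ∈ bᵏ∈ s t)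

  Gen₂-isIdeal : ∀ a b → IsIdeal m σ (Gen₂ m σ a b)
  Gen₂-isIdeal a b = record
    { has-zero = (0ℤ , 0ℤ) , (0ℤ , 0ℤ) , sym zero-combination
    ; closed-+ = λ { (r , s , refl) (r′ , s′ , refl) → r ⊞ r′ , s ⊞ s′ , sym (combination-+ r s r′ s′) }
    ; closed-* = λ { t (r , s , refl) → t ⊛ r , t ⊛ s , combination-* t r s }
    }
    where
    zero-combination : (0ℤ , 0ℤ) ⊛ a ⊞ (0ℤ , 0ℤ) ⊛ b ≡ (0ℤ , 0ℤ)
    zero-combination = cong₂ _⊞_ (trans (⊛-comm _ a) (⊛-zeroʳ a)) (trans (⊛-comm _ b) (⊛-zeroʳ b))
    distribʳ : ∀ r r′ c → (r ⊞ r′) ⊛ c ≡ r ⊛ c ⊞ r′ ⊛ c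
    distribʳ r r′ c = trans (⊛-comm _ c) (trans (⊛-distribˡ-⊞ c r r′) (cong₂ _⊞_ (⊛-comm c r) (⊛-comm c r′)))
    combination-+ : ∀ r s r′ s′ → (r ⊞ r′) ⊛ a ⊞ (s ⊞ s′) ⊛ b ≡ (r ⊛ a ⊞ s ⊛ b) ⊞ (r′ ⊛ a ⊞ s′ ⊛ b)
    combination-+ r s r′ s′ = trans (cong₂ _⊞_ (distribʳ r r′ a) (distribʳ s s′ b)) (⊞-interchange (r ⊛ a) (r′ ⊛ a) (s ⊛ b) (s′ ⊛ b))
    combination-* : ∀ t r s → t ⊛ (r ⊛ a ⊞ s ⊛ b) ≡ t ⊛ r ⊛ a ⊞ t ⊛ s ⊛ b
    combination-* t r s = trans (⊛-distribˡ-⊞ t _ _) (cong₂ _⊞_ (sym (⊛-assoc t r a)) (sym (⊛-assoc t s b)))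

  Gen₂-∋ˡ : ∀ a b → Gen₂ m σ a b a
  Gen₂-∋ˡ (a₁ , a₂) (b₁ , b₂) = (1ℤ , 0ℤ) , (0ℤ , 0ℤ) , cong₂ _,_ (lemma₁ a₁ a₂ b₁ b₂ m) (lemma₂ a₁ a₂ b₁ b₂ σ)
    where
    lemma₁ : ∀ a₁ a₂ b₁ b₂ m → a₁ ≡ 1ℤ * a₁ + m * 0ℤ * a₂ + (0ℤ * b₁ + m * 0ℤ * b₂)
    lemma₁ = solve-∀
    lemma₂ : ∀ a₁ a₂ b₁ b₂ σ → a₂ ≡ 1ℤ * a₂ + 0ℤ * a₁ + σ * 0ℤ * a₂ + (0ℤ * b₂ + 0ℤ * b₁ + σ * 0ℤ * b₂)
    lemma₂ = solve-∀

  Gen₂-∋ʳ : ∀ a b → Gen₂ m σ a b b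
  Gen₂-∋ʳ (a₁ , a₂) (b₁ , b₂) = (0ℤ , 0ℤ) , (1ℤ , 0ℤ) , cong₂ _,_ (lemma₁ a₁ a₂ b₁ b₂ m) (lemma₂ a₁ a₂ b₁ b₂ σ)
    where
    lemma₁ : ∀ a₁ a₂ b₁ b₂ m → b₁ ≡ 0ℤ * a₁ + m * 0ℤ * a₂ + (1ℤ * b₁ + m * 0ℤ * b₂)
    lemma₁ = solve-∀
    lemma₂ : ∀ a₁ a₂ b₁ b₂ σ → b₂ ≡ 0ℤ * a₂ + 0ℤ * a₁ + σ * 0ℤ * a₂ + (1ℤ * b₂ + 0ℤ * b₁ + σ * 0ℤ * b₂)
    lemma₂ = solve-∀

  Gen₂-least : ∀ {I} → IsIdeal m σ I → ∀ {a b} → I a → I b → Gen₂ m σ a b ⊆ I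
  Gen₂-least {I} I-ideal a∈ b∈ _ (r , s , refl) = ∈-⊛⊞⊛ I-ideal a∈ b∈ r s

  Prod-isIdeal : ∀ {I J} → IsIdeal m σ I → IsIdeal m σ (Prod m σ I J)
  Prod-isIdeal {I} {J} I-ideal = record { has-zero = pzero ; closed-+ = padd ; closed-* = closed-* }
    where
    closed-* : ∀ r {z} → Prod m σ I J z → Prod m σ I J (r ⊛ z)
    closed-* r pzero = subst (Prod m σ I J) (sym (⊛-zeroʳ r)) pzero
    closed-* r (pgen {a} {b} a∈ b∈) = subst (Prod m σ I J) (⊛-assoc r a b) (pgen (IsIdeal.closed-* I-ideal r a∈) b∈)
    closed-* r (padd {z} {w} z∈ w∈) = subst (Prod m σ I J) (sym (⊛-distribˡ-⊞ r z w)) (padd (closed-* r z∈) (closed-* r w∈))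

  Prod-monoʳ : ∀ {I J J′} → J ⊆ J′ → Prod m σ I J ⊆ Prod m σ I J′
  Prod-monoʳ J⊆J′ _ pzero       = pzero
  Prod-monoʳ J⊆J′ _ (pgen a∈ b∈) = pgen a∈ (J⊆J′ _ b∈)
  Prod-monoʳ J⊆J′ _ (padd z∈ w∈) = padd (Prod-monoʳ J⊆J′ _ z∈) (Prod-monoʳ J⊆J′ _ w∈)

  -- f x = N(x + ω).  The ideals of the argument are the ℤ-lattices ⟨ M , x +ω⟩ = Mℤ + (x + ω)ℤ with
  -- M ∣ f x, and ev x is reduction modulo such a lattice (the ring map ω ↦ - x modulo f x).
  f : ℤ → ℤ
  f x = x * x + σ * x - m

  ev : ℤ → Elt → ℤ
  ev x (z₁ , z₂) = z₁ - x * z₂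

  record ⟨_,_+ω⟩ (M x : ℤ) (z : Elt) : Set where
    constructor ∈⟨⟩
    field M∣ev : M ∣ ev x z

  open ⟨_,_+ω⟩

  ev-⊞ : ∀ x z w → ev x (z ⊞ w) ≡ ev x z + ev x w
  ev-⊞ x (z₁ , z₂) (w₁ , w₂) = lemma x z₁ z₂ w₁ w₂
    where
    lemma : ∀ x z₁ z₂ w₁ w₂ → z₁ + w₁ - x * (z₂ + w₂) ≡ z₁ - x * z₂ + (w₁ - x * w₂)
    lemma = solve-∀

  ev-⊛ : ∀ x z w → ev x (z ⊛ w) ≡ ev x z * ev x w - proj₂ z * proj₂ w * f x
  ev-⊛ x (z₁ , z₂) (w₁ , w₂) = lemma x z₁ z₂ w₁ w₂ m σ
    where
    lemma : ∀ x z₁ z₂ w₁ w₂ m σ →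
      z₁ * w₁ + m * z₂ * w₂ - x * (z₁ * w₂ + z₂ * w₁ + σ * z₂ * w₂) ≡ (z₁ - x * z₂) * (w₁ - x * w₂) - z₂ * w₂ * (x * x + σ * x - m)
    lemma = solve-∀

  ⟨⟩-isIdeal : ∀ {M} x → M ∣ f x → IsIdeal m σ ⟨ M , x +ω⟩
  ⟨⟩-isIdeal {M} x M∣fx = record
    { has-zero = ∈⟨⟩ (divides 0ℤ (lemma x))
    ; closed-+ = λ {z} {w} z∈ w∈ → ∈⟨⟩ (subst (M ∣_) (sym (ev-⊞ x z w)) (∣m∣n⇒∣m+n (M∣ev z∈) (M∣ev w∈)))
    ; closed-* = λ r {z} z∈ → ∈⟨⟩ (subst (M ∣_) (sym (ev-⊛ x r z))
        (∣m∣n⇒∣m-n (∣n⇒∣m*n (ev x r) (M∣ev z∈)) (∣n⇒∣m*n (proj₂ r * proj₂ z) M∣fx)))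
    }
    where
    lemma : ∀ x → 0ℤ - x * 0ℤ ≡ 0ℤ * M
    lemma = solve-∀

  M∈⟨M,x+ω⟩ : ∀ M x → ⟨ M , x +ω⟩ (M , 0ℤ)
  M∈⟨M,x+ω⟩ M x = ∈⟨⟩ (divides 1ℤ (lemma M x))
    where
    lemma : ∀ M x → M - x * 0ℤ ≡ 1ℤ * M
    lemma = solve-∀

  x+ω∈⟨M,x+ω⟩ : ∀ M x → ⟨ M , x +ω⟩ (x , 1ℤ)
  x+ω∈⟨M,x+ω⟩ M x = ∈⟨⟩ (divides 0ℤ (lemma M x))
    where
    lemma : ∀ M x → x - x * 1ℤ ≡ 0ℤ * M
    lemma = solve-∀

  ⟨⟩-basis : ∀ {M x} z q → ev x z ≡ q * M → z ≡ (q , 0ℤ) ⊛ (M , 0ℤ) ⊞ (proj₂ z , 0ℤ) ⊛ (x , 1ℤ)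
  ⟨⟩-basis {M} {x} (z₁ , z₂) q ev≡ = cong₂ _,_
    (trans (sym (lemma₁ z₁ x z₂)) (trans (cong (_+ x * z₂) ev≡) (lemma₂ q M m z₂ x)))
    (lemma₃ q M σ z₂ x)
    where
    lemma₁ : ∀ z₁ x z₂ → z₁ - x * z₂ + x * z₂ ≡ z₁
    lemma₁ = solve-∀
    lemma₂ : ∀ q M m z₂ x → q * M + x * z₂ ≡ q * M + m * 0ℤ * 0ℤ + (z₂ * x + m * 0ℤ * 1ℤ)
    lemma₂ = solve-∀
    lemma₃ : ∀ q M σ z₂ x → z₂ ≡ q * 0ℤ + 0ℤ * M + σ * 0ℤ * 0ℤ + (z₂ * 1ℤ + 0ℤ * x + σ * 0ℤ * 1ℤ)
    lemma₃ = solve-∀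

  ⟨⟩-least : ∀ {I} → IsIdeal m σ I → ∀ {M x} → I (M , 0ℤ) → I (x , 1ℤ) → ⟨ M , x +ω⟩ ⊆ I
  ⟨⟩-least {I} I-ideal M∈ x+ω∈ z (∈⟨⟩ (divides q ev≡)) =
    subst I (sym (⟨⟩-basis z q ev≡)) (∈-⊛⊞⊛ I-ideal M∈ x+ω∈ (q , 0ℤ) (proj₂ z , 0ℤ))

  ⟨⟩-norm : ∀ e x → HasNorm m σ ⟨ + e , x +ω⟩ e
  ⟨⟩-norm e x =
    (+ e , 0ℤ) , (x , 1ℤ) , M∈⟨M,x+ω⟩ (+ e) x , x+ω∈⟨M,x+ω⟩ (+ e) x ,
    (λ { z (∈⟨⟩ (divides q ev≡)) → q , proj₂ z , ⟨⟩-basis z q ev≡ }) , cong ∣_∣ (lemma (+ e) x)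
    where
    lemma : ∀ E x → E * 1ℤ - 0ℤ * x ≡ E
    lemma = solve-∀

  ⟨⟩-mono : ∀ {D M x} → D ∣ M → ⟨ M , x +ω⟩ ⊆ ⟨ D , x +ω⟩
  ⟨⟩-mono D∣M _ (∈⟨⟩ M∣ev) = ∈⟨⟩ (∣-trans D∣M M∣ev)

  ⟨⟩-shift : ∀ {M x y} → M ∣ x - y → ⟨ M , y +ω⟩ ⊆ ⟨ M , x +ω⟩
  ⟨⟩-shift {M} {x} {y} M∣x-y (w₁ , w₂) (∈⟨⟩ M∣ev) =
    ∈⟨⟩ (subst (M ∣_) (lemma x y w₁ w₂) (∣m∣n⇒∣m-n M∣ev (∣m⇒∣m*n w₂ M∣x-y)))
    where
    lemma : ∀ x y w₁ w₂ → w₁ - y * w₂ - (x - y) * w₂ ≡ w₁ - x * w₂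
    lemma = solve-∀

  scalar-⊛-scalar : ∀ s p z → (s , 0ℤ) ⊛ ((p , 0ℤ) ⊛ z) ≡ (s * (p * proj₁ z) , s * (p * proj₂ z))
  scalar-⊛-scalar s p z = trans (scalar-⊛ s _) (cong (λ w → s * proj₁ w , s * proj₂ w) (scalar-⊛ p z))

  ∈-coprime-multiples : ∀ {I} → IsIdeal m σ I → ∀ {p q z} → Coprime p q →
    I ((p , 0ℤ) ⊛ z) → I ((q , 0ℤ) ⊛ z) → I z
  ∈-coprime-multiples {I} I-ideal {p} {q} {z} (s , t , st) pz∈ qz∈ =
    subst I (trans (cong₂ _⊞_ (scalar-⊛-scalar s p z) (scalar-⊛-scalar t q z))
                    (cong₂ _,_ (bézout-scale {s} {p} {t} {q} (proj₁ z) st) (bézout-scale {s} {p} {t} {q} (proj₂ z) st)))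
      (∈-⊛⊞⊛ I-ideal pz∈ qz∈ (s , 0ℤ) (t , 0ℤ))

  x+ω-squared : ∀ x → (x , 1ℤ) ⊛ (x , 1ℤ) ⊞ (f x , 0ℤ) ≡ (x + x + σ , 0ℤ) ⊛ (x , 1ℤ)
  x+ω-squared x = cong₂ _,_ (lemma₁ m σ x) (lemma₂ σ x)
    where
    lemma₁ : ∀ m σ x → x * x + m * 1ℤ * 1ℤ + (x * x + σ * x - m) ≡ (x + x + σ) * x + m * 0ℤ * 1ℤ
    lemma₁ = solve-∀
    lemma₂ : ∀ σ x → x * 1ℤ + 1ℤ * x + σ * 1ℤ * 1ℤ + 0ℤ ≡ (x + x + σ) * 1ℤ + 0ℤ * x + σ * 0ℤ * 1ℤ
    lemma₂ = solve-∀

  Prod-⟨⟩ : ∀ {a b x} → a * b ∣ f x → Coprime a (x + x + σ) →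
    Prod m σ ⟨ a , x +ω⟩ ⟨ b , x +ω⟩ ≐ ⟨ a * b , x +ω⟩
  Prod-⟨⟩ {a} {b} {x} ab∣fx a⊥2x+σ = Prod⊆ , ⟨⟩-least Prod-ideal ab∈ x+ω∈
    where
    𝔞𝔟 = Prod m σ ⟨ a , x +ω⟩ ⟨ b , x +ω⟩
    ab-ideal = ⟨⟩-isIdeal x ab∣fx
    Prod-ideal = Prod-isIdeal {J = ⟨ b , x +ω⟩} (⟨⟩-isIdeal x (∣-trans (∣m⇒∣m*n b ∣-refl) ab∣fx))

    Prod⊆ : 𝔞𝔟 ⊆ ⟨ a * b , x +ω⟩
    Prod⊆ _ pzero                        = IsIdeal.has-zero ab-ideal
    Prod⊆ _ (pgen {a = z} {b = w} z∈ w∈) = ∈⟨⟩ (subst (a * b ∣_) (sym (ev-⊛ x z w))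
      (∣m∣n⇒∣m-n (∣-*-∣ (M∣ev z∈) (M∣ev w∈)) (∣n⇒∣m*n (proj₂ z * proj₂ w) ab∣fx)))
    Prod⊆ _ (padd z∈ w∈)                 = IsIdeal.closed-+ ab-ideal (Prod⊆ _ z∈) (Prod⊆ _ w∈)

    ab∈ : 𝔞𝔟 (a * b , 0ℤ)
    ab∈ = subst 𝔞𝔟 (trans (scalar-⊛ a (b , 0ℤ)) (cong (a * b ,_) (ℤ.*-zeroʳ a)))
      (pgen (M∈⟨M,x+ω⟩ a x) (M∈⟨M,x+ω⟩ b x))

    fx∈ : a * b ∣ f x → 𝔞𝔟 (f x , 0ℤ)
    fx∈ (divides c fx≡) = subst 𝔞𝔟 (trans (scalar-⊛ c (a * b , 0ℤ)) (cong₂ _,_ (sym fx≡) (ℤ.*-zeroʳ c)))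
      (IsIdeal.closed-* Prod-ideal (c , 0ℤ) ab∈)

    x+ω∈ : 𝔞𝔟 (x , 1ℤ)
    x+ω∈ = ∈-coprime-multiples Prod-ideal a⊥2x+σ
      (pgen (M∈⟨M,x+ω⟩ a x) (x+ω∈⟨M,x+ω⟩ b x))
      (subst 𝔞𝔟 (x+ω-squared x) (padd (pgen (x+ω∈⟨M,x+ω⟩ a x) (x+ω∈⟨M,x+ω⟩ b x)) (fx∈ ab∣fx)))

  Pow-⟨⟩ : ∀ {E x} k → E ^ℤ k ∣ f x → Coprime E (x + x + σ) → Pow m σ ⟨ E , x +ω⟩ k ≐ ⟨ E ^ℤ k , x +ω⟩
  Pow-⟨⟩ {x = x} zero _ _ = (λ z _ → ∈⟨⟩ (divides (ev x z) (sym (ℤ.*-identityʳ (ev x z))))) , (λ _ _ → tt)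
  Pow-⟨⟩ {E} {x} (suc k) Eᵏ⁺¹∣fx E⊥2x+σ =
    ≐-trans (Prod-monoʳ (proj₁ 𝔢ᵏ≐) , Prod-monoʳ (proj₂ 𝔢ᵏ≐)) (Prod-⟨⟩ Eᵏ⁺¹∣fx E⊥2x+σ)
    where
    𝔢ᵏ≐ = Pow-⟨⟩ k (∣-trans (i^n∣i^[1+n] E k) Eᵏ⁺¹∣fx) E⊥2x+σ

  ∣-⊛ : ∀ {D} r γ → D ∣ proj₁ γ → D ∣ proj₂ γ → (D ∣ proj₁ (r ⊛ γ)) × (D ∣ proj₂ (r ⊛ γ))
  ∣-⊛ (r₁ , r₂) γ D∣γ₁ D∣γ₂ =
    ∣m∣n⇒∣m+n (∣n⇒∣m*n r₁ D∣γ₁) (∣n⇒∣m*n (m * r₂) D∣γ₂) ,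
    ∣m∣n⇒∣m+n (∣m∣n⇒∣m+n (∣n⇒∣m*n r₁ D∣γ₂) (∣n⇒∣m*n r₂ D∣γ₁)) (∣n⇒∣m*n (σ * r₂) D∣γ₂)

  conj-⊛-self : ∀ a b → conj m σ (a , b) ⊛ (a , b) ≡ (Q₀ m σ a b , 0ℤ)
  conj-⊛-self a b = cong₂ _,_ (lemma₁ m σ a b) (lemma₂ σ a b)
    where
    lemma₁ : ∀ m σ a b → (a + σ * b) * a + m * (- b) * b ≡ a * a + σ * a * b - m * b * b
    lemma₁ = solve-∀
    lemma₂ : ∀ σ a b → (a + σ * b) * b + (- b) * a + σ * (- b) * b ≡ 0ℤ
    lemma₂ = solve-∀

  ∈-norm : ∀ {I} → IsIdeal m σ I → ∀ {a b} → I (a , b) → I (Q₀ m σ a b , 0ℤ)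
  ∈-norm {I} I-ideal {a} {b} α∈ = subst I (conj-⊛-self a b) (IsIdeal.closed-* I-ideal (conj m σ (a , b)) α∈)

  ∣-norm : ∀ {D} a b c d → Coprime c d → D ∣ proj₁ ((a , b) ⊛ (c , d)) → D ∣ proj₂ ((a , b) ⊛ (c , d)) →
    D ∣ Q₀ m σ a b
  ∣-norm {D} a b c d c⊥d D∣₁ D∣₂ = coprime-∣-multiples c⊥d
    (subst (D ∣_) (trans (cong proj₁ conj-α-αβ) (ℤ.*-comm (Q₀ m σ a b) c)) (proj₁ D∣conj-α-αβ))
    (subst (D ∣_) (trans (cong proj₂ conj-α-αβ) (ℤ.*-comm (Q₀ m σ a b) d)) (proj₂ D∣conj-α-αβ))
    where
    open ≡-Reasoning
    D∣conj-α-αβ = ∣-⊛ (conj m σ (a , b)) ((a , b) ⊛ (c , d)) D∣₁ D∣₂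
    conj-α-αβ : conj m σ (a , b) ⊛ ((a , b) ⊛ (c , d)) ≡ (Q₀ m σ a b * c , Q₀ m σ a b * d)
    conj-α-αβ = begin
      conj m σ (a , b) ⊛ ((a , b) ⊛ (c , d)) ≡⟨ ⊛-assoc (conj m σ (a , b)) (a , b) (c , d) ⟨
      conj m σ (a , b) ⊛ (a , b) ⊛ (c , d)   ≡⟨ cong (_⊛ (c , d)) (conj-⊛-self a b) ⟩
      (Q₀ m σ a b , 0ℤ) ⊛ (c , d)            ≡⟨ scalar-⊛ (Q₀ m σ a b) (c , d) ⟩
      (Q₀ m σ a b * c , Q₀ m σ a b * d)      ∎

  conj-⊛₁-∣ : ∀ {D x z w} → D ∣ f x → ⟨ D , x +ω⟩ z → ⟨ D , x +ω⟩ w → D ∣ proj₁ (z ⊛ conj m σ w)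
  conj-⊛₁-∣ {D} {x} {z₁ , z₂} {w₁ , w₂} D∣fx (∈⟨⟩ z∈) (∈⟨⟩ w∈) =
    subst (D ∣_) (sym (lemma m σ x z₁ z₂ w₁ w₂))
      (∣m∣n⇒∣m+n (∣m∣n⇒∣m+n (∣m⇒∣m*n (w₁ - x * w₂ + x * w₂ + σ * w₂) z∈) (∣m⇒∣m*n (x * z₂) w∈))
                 (∣n⇒∣m*n (z₂ * w₂) D∣fx))
    where
    lemma : ∀ m σ x z₁ z₂ w₁ w₂ → z₁ * (w₁ + σ * w₂) + m * z₂ * (- w₂)
      ≡ (z₁ - x * z₂) * (w₁ - x * w₂ + x * w₂ + σ * w₂) + (w₁ - x * w₂) * (x * z₂) + z₂ * w₂ * (x * x + σ * x - m)
    lemma = solve-∀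

  conj-⊛₂-∣ : ∀ {D x y z w} → ⟨ D , x +ω⟩ z → ⟨ D , y +ω⟩ w →
    D ∣ proj₂ (z ⊛ conj m σ w) + proj₂ z * proj₂ w * (x - y)
  conj-⊛₂-∣ {D} {x} {y} {z₁ , z₂} {w₁ , w₂} (∈⟨⟩ z∈) (∈⟨⟩ w∈) =
    subst (D ∣_) (sym (lemma σ x y z₁ z₂ w₁ w₂)) (∣m∣n⇒∣m-n (∣n⇒∣m*n z₂ w∈) (∣n⇒∣m*n w₂ z∈))
    where
    lemma : ∀ σ x y z₁ z₂ w₁ w₂ → z₁ * (- w₂) + z₂ * (w₁ + σ * w₂) + σ * z₂ * (- w₂) + z₂ * w₂ * (x - y)
      ≡ z₂ * (w₁ - y * w₂) - w₂ * (z₁ - x * z₂)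
    lemma = solve-∀

  Q₀-conj : ∀ B C → Q₀ m σ (B + σ * C) (- C) ≡ Q₀ m σ B C
  Q₀-conj B C = lemma m σ B C
    where
    lemma : ∀ m σ B C → (B + σ * C) * (B + σ * C) + σ * (B + σ * C) * (- C) - m * (- C) * (- C)
      ≡ B * B + σ * B * C - m * C * C
    lemma = solve-∀

  coprime-conj : ∀ {B C} → Coprime B C → Coprime (B + σ * C) (- C)
  coprime-conj {B} {C} (s , t , st) = s , s * σ - t , trans (lemma σ s t B C) st
    where
    lemma : ∀ σ s t B C → s * (B + σ * C) + (s * σ - t) * (- C) ≡ s * B + t * C
    lemma = solve-∀

  Q₀-coprimeˡ : ∀ {B C} → Coprime B C → Coprime (Q₀ m σ B C) C
  Q₀-coprimeˡ {B} {C} B⊥C = coprime-sym (coprime-resp-∣- C∣B²-Q₀ (coprime-sym (coprime-*ˡ B⊥C B⊥C)))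
    where
    lemma : ∀ m σ B C → B * B - (B * B + σ * B * C - m * C * C) ≡ (m * C - σ * B) * C
    lemma = solve-∀
    C∣B²-Q₀ : C ∣ B * B - Q₀ m σ B C
    C∣B²-Q₀ = divides (m * C - σ * B) (lemma m σ B C)

  -- B + C ω ≡ C (x + ω) modulo N = N(B + C ω).
  record Root (N B C : ℤ) : Set where
    field
      x          : ℤ
      α∈⟨N,x+ω⟩ : ⟨ N , x +ω⟩ (B , C)
      N∣fx       : N ∣ f x
      N⊥C        : Coprime N C

  root : ∀ {N B C} → Coprime B C → Q₀ m σ B C ≡ N → Root N B C
  root {N} {B} {C} B⊥C Q≡N = from (subst (λ M → Coprime M C) Q≡N (Q₀-coprimeˡ B⊥C))
    where
    from : Coprime N C → Root N B C
    from N⊥C@(s , t , st) = record { x = B * t ; α∈⟨N,x+ω⟩ = α∈ ; N∣fx = N∣fx ; N⊥C = N⊥C }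
      where
      open ≡-Reasoning
      α∈ : ⟨ N , B * t +ω⟩ (B , C)
      α∈ = ∈⟨⟩ (divides (s * B) (begin
        B - B * t * C                   ≡⟨ lemma₁ B t C ⟩
        B * 1ℤ - B * t * C              ≡⟨ cong (λ r → B * r - B * t * C) (sym st) ⟩
        B * (s * N + t * C) - B * t * C ≡⟨ lemma₂ B s N t C ⟩
        s * B * N                       ∎))
        where
        lemma₁ : ∀ B t C → B - B * t * C ≡ B * 1ℤ - B * t * C
        lemma₁ = solve-∀
        lemma₂ : ∀ B s N t C → B * (s * N + t * C) - B * t * C ≡ s * B * N
        lemma₂ = solve-∀
      lemma : ∀ m σ B C x → C * C * (x * x + σ * x - m)
        ≡ (B * B + σ * B * C - m * C * C) - (B - x * C) * (B + x * C + σ * C)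
      lemma = solve-∀
      N∣fx : N ∣ f (B * t)
      N∣fx = coprime-divisor (coprime-sym (coprime-*ˡ (coprime-sym N⊥C) (coprime-sym N⊥C)))
        (subst (N ∣_) (sym (lemma m σ B C (B * t)))
          (∣m∣n⇒∣m-n (subst (N ∣_) (sym Q≡N) ∣-refl) (∣m⇒∣m*n (B + B * t * C + σ * C) (M∣ev α∈))))

  -- N (x + ω) and C (x + ω) = (B + C ω) - k N both lie in I, and N ⊥ C.
  Root-x+ω∈ : ∀ {I} → IsIdeal m σ I → ∀ {N B C} → I (N , 0ℤ) → I (B , C) → (r : Root N B C) → I (Root.x r , 1ℤ)
  Root-x+ω∈ {I} I-ideal {N} {B} {C} N∈ α∈ r with Root.α∈⟨N,x+ω⟩ r
  ... | ∈⟨⟩ (divides k ev≡) = ∈-coprime-multiples I-ideal (Root.N⊥C r)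
    (subst I (⊛-comm (x , 1ℤ) (N , 0ℤ)) (IsIdeal.closed-* I-ideal (x , 1ℤ) N∈))
    (subst I (sym C[x+ω]) (IsIdeal.closed-+ I-ideal α∈ (IsIdeal.closed-* I-ideal (- k , 0ℤ) N∈)))
    where
    open ≡-Reasoning
    x = Root.x r
    lemma₁ : ∀ B x C → C * x ≡ B - (B - x * C)
    lemma₁ = solve-∀
    lemma₂ : ∀ B k N → B - k * N ≡ B + - k * N
    lemma₂ = solve-∀
    lemma₃ : ∀ C k → C * 1ℤ ≡ C + - k * 0ℤ
    lemma₃ = solve-∀
    C[x+ω] : (C , 0ℤ) ⊛ (x , 1ℤ) ≡ (B , C) ⊞ (- k , 0ℤ) ⊛ (N , 0ℤ)
    C[x+ω] = begin
      (C , 0ℤ) ⊛ (x , 1ℤ)              ≡⟨ scalar-⊛ C (x , 1ℤ) ⟩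
      (C * x , C * 1ℤ)                 ≡⟨ cong₂ _,_ (trans (lemma₁ B x C) (trans (cong (λ u → B - u) ev≡) (lemma₂ B k N)))
                                                      (lemma₃ C k) ⟩
      (B + - k * N , C + - k * 0ℤ)     ≡⟨ cong (λ w → (B , C) ⊞ w) (scalar-⊛ (- k) (N , 0ℤ)) ⟨
      (B , C) ⊞ (- k , 0ℤ) ⊛ (N , 0ℤ)  ∎

-- Fundamental discriminants

parity : ∀ a → Σ ℤ λ q → a ≡ q + q ⊎ a ≡ q + q + 1ℤ
parity a with a %ℕ 2 | n%ℕd<d a 2 | a≡a%ℕn+[a/ℕn]*n a 2
... | 0           | _             | a≡ = a /ℕ 2 , inj₁ (trans a≡ (lemma₀ (a /ℕ 2)))
  where
  lemma₀ : ∀ q → + 0 + q * + 2 ≡ q + q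
  lemma₀ = solve-∀
... | 1           | _             | a≡ = a /ℕ 2 , inj₂ (trans a≡ (lemma₁ (a /ℕ 2)))
  where
  lemma₁ : ∀ q → + 1 + q * + 2 ≡ q + q + 1ℤ
  lemma₁ = solve-∀
... | suc (suc _) | s≤s (s≤s ()) | _

square-mod-4 : ∀ x → Σ ℤ λ w → x * x ≡ + 4 * w + + 0 ⊎ x * x ≡ + 4 * w + + 1
square-mod-4 x with parity x
... | q , inj₁ refl = q * q , inj₁ (lemma₀ q)
  where
  lemma₀ : ∀ q → (q + q) * (q + q) ≡ + 4 * (q * q) + + 0
  lemma₀ = solve-∀
... | q , inj₂ refl = q * q + q , inj₂ (lemma₁ q)
  where
  lemma₁ : ∀ q → (q + q + 1ℤ) * (q + q + 1ℤ) ≡ + 4 * (q * q + q) + + 1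
  lemma₁ = solve-∀

4*-difference : ∀ a b r s → + 4 * a + r ≡ + 4 * b + s → + 4 * (a - b) ≡ s - r
4*-difference a b r s eq = begin
  + 4 * (a - b)                               ≡⟨ lemma₁ a b r s ⟩
  (+ 4 * a + r) - (+ 4 * b + s) + (s - r)     ≡⟨ cong (λ u → u - (+ 4 * b + s) + (s - r)) eq ⟩
  (+ 4 * b + s) - (+ 4 * b + s) + (s - r)     ≡⟨ lemma₂ (+ 4 * b + s) (s - r) ⟩
  s - r                                       ∎
  where
  open ≡-Reasoning
  lemma₁ : ∀ a b r s → + 4 * (a - b) ≡ (+ 4 * a + r) - (+ 4 * b + s) + (s - r)
  lemma₁ = solve-∀
  lemma₂ : ∀ u v → u - u + v ≡ v
  lemma₂ = solve-∀

4∤ : ∀ {a r} → False (4 ℕᵈ.∣? r) → + 4 * a ≢ + r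
4∤ {a} 4∤r eq = toWitnessFalse 4∤r (∣⇒∣ᵤ (divides a (trans (sym eq) (ℤ.*-comm (+ 4) a))))

square≢2,3-mod-4 : ∀ x w r → r ≡ 2 ⊎ r ≡ 3 → x * x ≢ + 4 * w + + r
square≢2,3-mod-4 x w r r≡2,3 x²≡ with square-mod-4 x | r≡2,3
... | v , inj₁ x²≡4v   | inj₁ refl = 4∤ tt (4*-difference v w (+ 0) (+ 2) (trans (sym x²≡4v) x²≡))
... | v , inj₁ x²≡4v   | inj₂ refl = 4∤ tt (4*-difference v w (+ 0) (+ 3) (trans (sym x²≡4v) x²≡))
... | v , inj₂ x²≡4v+1 | inj₁ refl = 4∤ tt (4*-difference v w (+ 1) (+ 2) (trans (sym x²≡4v+1) x²≡))
... | v , inj₂ x²≡4v+1 | inj₂ refl = 4∤ tt (4*-difference v w (+ 1) (+ 3) (trans (sym x²≡4v+1) x²≡))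

disc-identity : ∀ {σ} m x → σ ≡ + 0 ⊎ σ ≡ + 1 → (x + x + σ) * (x + x + σ) - + 4 * (x * x + σ * x - m) ≡ disc m σ
disc-identity m x (inj₁ refl) = lemma₀ m x
  where
  lemma₀ : ∀ m x → (x + x + + 0) * (x + x + + 0) - + 4 * (x * x + + 0 * x - m) ≡ + 4 * m + + 0
  lemma₀ = solve-∀
disc-identity m x (inj₂ refl) = lemma₁ m x
  where
  lemma₁ : ∀ m x → (x + x + + 1) * (x + x + + 1) - + 4 * (x * x + + 1 * x - m) ≡ + 4 * m + + 1
  lemma₁ = solve-∀

squarefree-coprime : ∀ {D} a b → SquareFree D → (∀ {h} → h ∣ a → h ∣ b → h * h ∣ D) → Coprime a b
squarefree-coprime {D} a b D-squarefree common∣ =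
  gcd≡1⇒coprime a b (D-squarefree g (subst (ℕᵈ._∣ ∣ D ∣) (ℤ.abs-* (+ g) (+ g)) (∣⇒∣ᵤ (common∣ {+ g} g∣a g∣b))))
  where
  g = gcd ∣ a ∣ ∣ b ∣
  g∣a : + g ∣ a
  g∣a = ∣ᵤ⇒∣ (gcd[m,n]∣m ∣ a ∣ ∣ b ∣)
  g∣b : + g ∣ b
  g∣b = ∣ᵤ⇒∣ (gcd[m,n]∣n ∣ a ∣ ∣ b ∣)

-- If 2 ∣ A then 4 ∣ Aⁿ ∣ x² - c, so x² ≡ c ≡ 2, 3 modulo 4.
2,3-mod-4⇒coprime-2 : ∀ {n A} x c → 2 ≤ n → (∃[ t ] c ≡ + 4 * t + + 2) ⊎ (∃[ t ] c ≡ + 4 * t + + 3) →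
  A ^ℤ n ∣ x * x - c → Coprime A (+ 2)
2,3-mod-4⇒coprime-2 {n} {A} x c 2≤n c≡2,3 Aⁿ∣x²-c with parity A
... | q , inj₂ A≡ = 1ℤ , - q , trans (cong (λ a → 1ℤ * a + - q * + 2) A≡) (lemma q)
  where
  lemma : ∀ q → 1ℤ * (q + q + 1ℤ) + - q * + 2 ≡ 1ℤ
  lemma = solve-∀
... | q , inj₁ A≡ with ∣-trans (h∣i⇒h*h∣i^n n 2≤n (∣-reflexive (sym A≡))) Aⁿ∣x²-c
...   | divides l x²-c≡ = ⊥-elim (c≢2,3 c≡2,3)
  where
  open ≡-Reasoning
  lemma₁ : ∀ x c → x * x ≡ (x * x - c) + c
  lemma₁ = solve-∀
  lemma₂ : ∀ l q t r → l * ((q + q) * (q + q)) + (+ 4 * t + r) ≡ + 4 * (l * (q * q) + t) + r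
  lemma₂ = solve-∀
  x²≡ : ∀ t r → c ≡ + 4 * t + + r → x * x ≡ + 4 * (l * (q * q) + t) + + r
  x²≡ t r c≡ = begin
    x * x                                     ≡⟨ lemma₁ x c ⟩
    (x * x - c) + c                           ≡⟨ cong₂ _+_ x²-c≡ c≡ ⟩
    l * ((q + q) * (q + q)) + (+ 4 * t + + r) ≡⟨ lemma₂ l q t (+ r) ⟩
    + 4 * (l * (q * q) + t) + + r             ∎
  c≢2,3 : (∃[ t ] c ≡ + 4 * t + + 2) ⊎ (∃[ t ] c ≡ + 4 * t + + 3) → ⊥
  c≢2,3 (inj₁ (t , c≡)) = square≢2,3-mod-4 x (l * (q * q) + t) 2 (inj₁ refl) (x²≡ t 2 c≡)
  c≢2,3 (inj₂ (t , c≡)) = square≢2,3-mod-4 x (l * (q * q) + t) 3 (inj₂ refl) (x²≡ t 3 c≡)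

-- A common factor h of A and 2x + σ has h² ∣ (2x + σ)² - 4 f x = Δ; for σ = 0 one instead treats
-- 2x as 2 times x, using h² ∣ x² - f x = m.
fundamental⇒coprime : ∀ m {σ} → σ ≡ + 0 ⊎ σ ≡ + 1 → IsFundamental (disc m σ) → ∀ {n A} x → 2 ≤ n →
  A ^ℤ n ∣ x * x + σ * x - m → Coprime A (x + x + σ)
fundamental⇒coprime m σ≡@(inj₂ refl) (_ , inj₁ (_ , Δ-squarefree)) {n} {A} x 2≤n Aⁿ∣fx =
  squarefree-coprime A (x + x + + 1) Δ-squarefree λ h∣A h∣t →
    subst (_ ∣_) (disc-identity m x σ≡)
      (∣m∣n⇒∣m-n (∣-*-∣ h∣t h∣t) (∣n⇒∣m*n (+ 4) (∣-trans (h∣i⇒h*h∣i^n n 2≤n h∣A) Aⁿ∣fx)))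
fundamental⇒coprime m (inj₂ refl) (_ , inj₂ (k , Δ≡4k , _)) _ _ _ =
  ⊥-elim (4∤ tt (4*-difference k m (+ 0) (+ 1) (trans (ℤ.+-identityʳ (+ 4 * k)) (sym Δ≡4k))))
fundamental⇒coprime m (inj₁ refl) (_ , inj₁ ((t , Δ≡4t+1) , _)) _ _ _ =
  ⊥-elim (4∤ tt (4*-difference m t (+ 0) (+ 1) Δ≡4t+1))
fundamental⇒coprime m (inj₁ refl) (_ , inj₂ (k , Δ≡4k , k≡2,3 , k-squarefree)) {n} {A} x 2≤n Aⁿ∣fx =
  subst (Coprime A) (lemma x) (coprime-sym (coprime-*ˡ (coprime-sym A⊥2) (coprime-sym A⊥x)))
  where
  lemma : ∀ x → + 2 * x ≡ x + x + + 0
  lemma = solve-∀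
  m≡k : m ≡ k
  m≡k = ℤ.*-cancelˡ-≡ (+ 4) m k (trans (sym (ℤ.+-identityʳ (+ 4 * m))) Δ≡4k)
  x²-fx≡m : ∀ m x → x * x - (x * x + + 0 * x - m) ≡ m
  x²-fx≡m = solve-∀
  A⊥x : Coprime A x
  A⊥x = squarefree-coprime A x k-squarefree λ h∣A h∣x →
    subst (_ ∣_) (trans (x²-fx≡m m x) m≡k) (∣m∣n⇒∣m-n (∣-*-∣ h∣x h∣x) (∣-trans (h∣i⇒h*h∣i^n n 2≤n h∣A) Aⁿ∣fx))
  A⊥2 : Coprime A (+ 2)
  A⊥2 = 2,3-mod-4⇒coprime-2 x k 2≤n k≡2,3 (subst (A ^ℤ n ∣_) (trans (lemma₁ m x) (cong (λ c → x * x - c) m≡k)) Aⁿ∣fx)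
    where
    lemma₁ : ∀ m x → x * x + + 0 * x - m ≡ x * x - m
    lemma₁ = solve-∀

∣i∣≡1⇒i*i≡1 : ∀ {i} → ∣ i ∣ ≡ 1 → i * i ≡ 1ℤ
∣i∣≡1⇒i*i≡1 {+ .1}          refl = refl
∣i∣≡1⇒i*i≡1 { -[1+ zero ] } refl = refl

-- A = 0 would force f x = 0 and 2x + σ = ±1, hence Δ = (2x + σ)² - 4 f x = 1.
fundamental⇒≢0 : ∀ m {σ} → σ ≡ + 0 ⊎ σ ≡ + 1 → IsFundamental (disc m σ) → ∀ {n A} x → 1 ≤ n →
  A ^ℤ n ∣ x * x + σ * x - m → Coprime A (x + x + σ) → A ≢ 0ℤ
fundamental⇒≢0 m {σ} σ≡ (Δ≢1 , _) {suc n} x _ 0∣fx (s , u , su≡1) refl =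
  Δ≢1 (trans (sym (disc-identity m x σ≡)) (cong₂ (λ a b → a - + 4 * b) t²≡1 (0∣⇒≡0 0∣fx)))
  where
  t = x + x + σ
  ut≡1 : u * t ≡ 1ℤ
  ut≡1 = trans (sym (trans (cong (_+ u * t) (ℤ.*-zeroʳ s)) (ℤ.+-identityˡ (u * t)))) su≡1
  t²≡1 : t * t ≡ 1ℤ
  t²≡1 = ∣i∣≡1⇒i*i≡1 {t} (ℕᵖ.m*n≡1⇒n≡1 ∣ u ∣ ∣ t ∣ (trans (sym (ℤ.abs-* u t)) (cong ∣_∣ ut≡1)))

module TwoSolutions (m σ : ℤ) (σ≡0,1 : σ ≡ + 0 ⊎ σ ≡ + 1) (fundamental : IsFundamental (disc m σ))
            (n : ℕ) (2≤n : 2 ≤ n) (A₁ B₁ C₁ A₂ B₂ C₂ : ℤ)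
            (S₁ : InS m σ n A₁ B₁ C₁) (S₂ : InS m σ n A₂ B₂ C₂) where

  open Quadratic m σ

  1≤n : 1 ≤ n
  1≤n = ℕᵖ.<⇒≤ 2≤n

  α₁ α₂ β : Elt
  α₁ = B₁ , C₁
  α₂ = B₂ , C₂
  β  = conj m σ α₂

  N₁ N₂ : ℤ
  N₁ = A₁ ^ℤ n
  N₂ = A₂ ^ℤ n

  B₁⊥C₁ : Coprime B₁ C₁
  B₁⊥C₁ = gcd≡1⇒coprime B₁ C₁ (proj₂ S₁)

  B₂⊥C₂ : Coprime B₂ C₂
  B₂⊥C₂ = gcd≡1⇒coprime B₂ C₂ (proj₂ S₂)

  Q₀β≡N₂ : Q₀ m σ (B₂ + σ * C₂) (- C₂) ≡ N₂
  Q₀β≡N₂ = trans (Q₀-conj B₂ C₂) (proj₁ S₂)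

  root₁ : Root N₁ B₁ C₁
  root₁ = root B₁⊥C₁ (proj₁ S₁)

  root₂ : Root N₂ (B₂ + σ * C₂) (- C₂)
  root₂ = root (coprime-conj B₂⊥C₂) Q₀β≡N₂

  open Root root₁ using (x) renaming (α∈⟨N,x+ω⟩ to α₁∈⟨N₁,x+ω⟩; N∣fx to N₁∣fx; N⊥C to N₁⊥C₁)
  open Root root₂ using () renaming (x to y; α∈⟨N,x+ω⟩ to β∈⟨N₂,y+ω⟩; N∣fx to N₂∣fy; N⊥C to N₂⊥-C₂)

  d : ℤ
  d = x - y

  P R : ℤ
  P = B₁ * B₂ + m * C₁ * C₂
  R = B₁ * C₂ + B₂ * C₁ + σ * C₁ * C₂

  g : ℕ
  g = gcd ∣ P ∣ ∣ R ∣

  e : ℕ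
  e = gcd (gcd ∣ A₁ ∣ ∣ A₂ ∣) ∣ d ∣

  E : ℤ
  E = + e

  P≡[α₁β̄]₁ : P ≡ proj₁ (α₁ ⊛ conj m σ β)
  P≡[α₁β̄]₁ = lemma m σ B₁ C₁ B₂ C₂
    where
    lemma : ∀ m σ B₁ C₁ B₂ C₂ → B₁ * B₂ + m * C₁ * C₂ ≡ B₁ * (B₂ + σ * C₂ + σ * - C₂) + m * C₁ * - - C₂
    lemma = solve-∀

  R≡[α₁β̄]₂ : R ≡ proj₂ (α₁ ⊛ conj m σ β)
  R≡[α₁β̄]₂ = lemma σ B₁ C₁ B₂ C₂
    where
    lemma : ∀ σ B₁ C₁ B₂ C₂ → B₁ * C₂ + B₂ * C₁ + σ * C₁ * C₂
      ≡ B₁ * - - C₂ + C₁ * (B₂ + σ * C₂ + σ * - C₂) + σ * C₁ * - - C₂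
    lemma = solve-∀

  g∣P : + g ∣ P
  g∣P = ∣ᵤ⇒∣ (gcd[m,n]∣m ∣ P ∣ ∣ R ∣)

  g∣R : + g ∣ R
  g∣R = ∣ᵤ⇒∣ (gcd[m,n]∣n ∣ P ∣ ∣ R ∣)

  g∣N₁ : + g ∣ N₁
  g∣N₁ = subst (+ g ∣_) (proj₁ S₁) (∣-norm B₁ C₁ B₂ C₂ B₂⊥C₂ g∣P (subst (+ g ∣_) (lemma σ B₁ C₁ B₂ C₂) g∣R))
    where
    lemma : ∀ σ B₁ C₁ B₂ C₂ → B₁ * C₂ + B₂ * C₁ + σ * C₁ * C₂ ≡ B₁ * C₂ + C₁ * B₂ + σ * C₁ * C₂
    lemma = solve-∀

  g∣N₂ : + g ∣ N₂
  g∣N₂ = subst (+ g ∣_) (proj₁ S₂)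
    (∣-norm B₂ C₂ B₁ C₁ B₁⊥C₁ (subst (+ g ∣_) (lemma₁ m B₁ C₁ B₂ C₂) g∣P) (subst (+ g ∣_) (lemma₂ σ B₁ C₁ B₂ C₂) g∣R))
    where
    lemma₁ : ∀ m B₁ C₁ B₂ C₂ → B₁ * B₂ + m * C₁ * C₂ ≡ B₂ * B₁ + m * C₂ * C₁
    lemma₁ = solve-∀
    lemma₂ : ∀ σ B₁ C₁ B₂ C₂ → B₁ * C₂ + B₂ * C₁ + σ * C₁ * C₂ ≡ B₂ * C₁ + C₂ * B₁ + σ * C₂ * C₁
    lemma₂ = solve-∀

  g∣d : + g ∣ d
  g∣d = coprime-divisor g⊥C₁C₂ (∣m+n∣m⇒∣n (conj-⊛₂-∣ α₁∈⟨g,x+ω⟩ β∈⟨g,y+ω⟩) (subst (+ g ∣_) R≡[α₁β̄]₂ g∣R))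
    where
    α₁∈⟨g,x+ω⟩ = ⟨⟩-mono g∣N₁ α₁ α₁∈⟨N₁,x+ω⟩
    β∈⟨g,y+ω⟩  = ⟨⟩-mono g∣N₂ β β∈⟨N₂,y+ω⟩
    g⊥C₁C₂ : Coprime (+ g) (C₁ * - C₂)
    g⊥C₁C₂ = coprime-sym (coprime-*ˡ (coprime-sym (coprime-∣ˡ g∣N₁ N₁⊥C₁)) (coprime-sym (coprime-∣ˡ g∣N₂ N₂⊥-C₂)))

  g∣Eⁿ : + g ∣ E ^ℤ n
  g∣Eⁿ = ∣-gcd-^ (+ gcd ∣ A₁ ∣ ∣ A₂ ∣) d n (∣-gcd-^ A₁ A₂ n g∣N₁ g∣N₂) (∣-trans g∣d (i∣i^n d 1≤n))

  E∣A₁ : E ∣ A₁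
  E∣A₁ = ∣ᵤ⇒∣ (ℕᵈ.∣-trans (gcd[m,n]∣m _ ∣ d ∣) (gcd[m,n]∣m ∣ A₁ ∣ ∣ A₂ ∣))

  E∣A₂ : E ∣ A₂
  E∣A₂ = ∣ᵤ⇒∣ (ℕᵈ.∣-trans (gcd[m,n]∣m _ ∣ d ∣) (gcd[m,n]∣n ∣ A₁ ∣ ∣ A₂ ∣))

  E∣d : E ∣ d
  E∣d = ∣ᵤ⇒∣ (gcd[m,n]∣n (gcd ∣ A₁ ∣ ∣ A₂ ∣) ∣ d ∣)

  Eⁿ∣N₁ : E ^ℤ n ∣ N₁
  Eⁿ∣N₁ = ^-monoˡ-∣ n E∣A₁

  Eⁿ∣N₂ : E ^ℤ n ∣ N₂
  Eⁿ∣N₂ = ^-monoˡ-∣ n E∣A₂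

  Eⁿ∣fx : E ^ℤ n ∣ f x
  Eⁿ∣fx = ∣-trans Eⁿ∣N₁ N₁∣fx

  A₁⊥2x+σ : Coprime A₁ (x + x + σ)
  A₁⊥2x+σ = fundamental⇒coprime m σ≡0,1 fundamental x 2≤n N₁∣fx

  E⊥2x+σ : Coprime E (x + x + σ)
  E⊥2x+σ = coprime-∣ˡ E∣A₁ A₁⊥2x+σ

  -- f x - f y = (x + y + σ)(x - y), and x + y + σ ≡ 2x + σ modulo e.
  Eⁿ∣d : E ^ℤ n ∣ d
  Eⁿ∣d = coprime-divisor (coprime-^ˡ n E⊥x+y+σ)
    (subst (E ^ℤ n ∣_) (lemma₂ m σ x y) (∣m∣n⇒∣m-n Eⁿ∣fx (∣-trans Eⁿ∣N₂ N₂∣fy)))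
    where
    lemma₁ : ∀ σ x y → x - y ≡ x + x + σ - (x + y + σ)
    lemma₁ = solve-∀
    lemma₂ : ∀ m σ x y → x * x + σ * x - m - (y * y + σ * y - m) ≡ (x + y + σ) * (x - y)
    lemma₂ = solve-∀
    E⊥x+y+σ : Coprime E (x + y + σ)
    E⊥x+y+σ = coprime-resp-∣- (subst (E ∣_) (lemma₁ σ x y) E∣d) E⊥2x+σ

  α₁∈⟨Eⁿ,x+ω⟩ : ⟨ E ^ℤ n , x +ω⟩ α₁
  α₁∈⟨Eⁿ,x+ω⟩ = ⟨⟩-mono Eⁿ∣N₁ α₁ α₁∈⟨N₁,x+ω⟩

  β∈⟨Eⁿ,y+ω⟩ : ⟨ E ^ℤ n , y +ω⟩ β
  β∈⟨Eⁿ,y+ω⟩ = ⟨⟩-mono Eⁿ∣N₂ β β∈⟨N₂,y+ω⟩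

  β∈⟨Eⁿ,x+ω⟩ : ⟨ E ^ℤ n , x +ω⟩ β
  β∈⟨Eⁿ,x+ω⟩ = ⟨⟩-shift Eⁿ∣d β β∈⟨Eⁿ,y+ω⟩

  eⁿ∣g : e ^ n ℕᵈ.∣ g
  eⁿ∣g = gcd-greatest (∣ᵤ Eⁿ∣P) (∣ᵤ Eⁿ∣R)
    where
    ∣ᵤ : ∀ {a} → E ^ℤ n ∣ a → e ^ n ℕᵈ.∣ ∣ a ∣
    ∣ᵤ Eⁿ∣a = subst (ℕᵈ._∣ _) (cong ∣_∣ (pos-^ e n)) (∣⇒∣ᵤ Eⁿ∣a)
    Eⁿ∣P : E ^ℤ n ∣ P
    Eⁿ∣P = subst (E ^ℤ n ∣_) (sym P≡[α₁β̄]₁) (conj-⊛₁-∣ Eⁿ∣fx α₁∈⟨Eⁿ,x+ω⟩ β∈⟨Eⁿ,x+ω⟩)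
    Eⁿ∣R : E ^ℤ n ∣ R
    Eⁿ∣R = subst (E ^ℤ n ∣_) (sym R≡[α₁β̄]₂)
      (∣m+n∣n⇒∣m (conj-⊛₂-∣ α₁∈⟨Eⁿ,x+ω⟩ β∈⟨Eⁿ,y+ω⟩) (∣n⇒∣m*n (C₁ * - C₂) Eⁿ∣d))

  g≡eⁿ : g ≡ e ^ n
  g≡eⁿ = ℕᵈ.∣-antisym (subst (g ℕᵈ.∣_) (cong ∣_∣ (pos-^ e n)) (∣⇒∣ᵤ g∣Eⁿ)) eⁿ∣g

  0<e : 0 < e
  0<e = ℕᵖ.n≢0⇒n>0 λ e≡0 →
    fundamental⇒≢0 m σ≡0,1 fundamental x 1≤n N₁∣fx A₁⊥2x+σ
      (ℤ.∣i∣≡0⇒i≡0 (gcd[m,n]≡0⇒m≡0 (gcd[m,n]≡0⇒m≡0 e≡0)))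

  𝔡 : Elt → Set
  𝔡 = Gen₂ m σ α₁ β

  𝔡-isIdeal : IsIdeal m σ 𝔡
  𝔡-isIdeal = Gen₂-isIdeal α₁ β

  N₁∈𝔡 : 𝔡 (N₁ , 0ℤ)
  N₁∈𝔡 = subst (λ N → 𝔡 (N , 0ℤ)) (proj₁ S₁) (∈-norm 𝔡-isIdeal (Gen₂-∋ˡ α₁ β))

  N₂∈𝔡 : 𝔡 (N₂ , 0ℤ)
  N₂∈𝔡 = subst (λ N → 𝔡 (N , 0ℤ)) Q₀β≡N₂ (∈-norm 𝔡-isIdeal (Gen₂-∋ʳ α₁ β))

  x+ω∈𝔡 : 𝔡 (x , 1ℤ)
  x+ω∈𝔡 = Root-x+ω∈ 𝔡-isIdeal N₁∈𝔡 (Gen₂-∋ˡ α₁ β) root₁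

  y+ω∈𝔡 : 𝔡 (y , 1ℤ)
  y+ω∈𝔡 = Root-x+ω∈ 𝔡-isIdeal N₂∈𝔡 (Gen₂-∋ʳ α₁ β) root₂

  d∈𝔡 : 𝔡 (d , 0ℤ)
  d∈𝔡 = subst 𝔡 (trans (cong ((x , 1ℤ) ⊞_) (scalar-⊛ (- 1ℤ) (y , 1ℤ))) (cong₂ _,_ (lemma x y) refl))
    (IsIdeal.closed-+ 𝔡-isIdeal x+ω∈𝔡 (IsIdeal.closed-* 𝔡-isIdeal (- 1ℤ , 0ℤ) y+ω∈𝔡))
    where
    lemma : ∀ x y → x + - 1ℤ * y ≡ x - y
    lemma = solve-∀

  Eⁿ∈𝔡 : 𝔡 (E ^ℤ n , 0ℤ)
  Eⁿ∈𝔡 = ∈-gcd-^ 𝔡-isIdeal (+ gcd ∣ A₁ ∣ ∣ A₂ ∣) d n (∈-gcd-^ 𝔡-isIdeal A₁ A₂ n N₁∈𝔡 N₂∈𝔡) (∈-ℤ-^ 𝔡-isIdeal n 1≤n d∈𝔡)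

  𝔡≐⟨Eⁿ,x+ω⟩ : 𝔡 ≐ ⟨ E ^ℤ n , x +ω⟩
  𝔡≐⟨Eⁿ,x+ω⟩ = Gen₂-least (⟨⟩-isIdeal x Eⁿ∣fx) α₁∈⟨Eⁿ,x+ω⟩ β∈⟨Eⁿ,x+ω⟩ , ⟨⟩-least 𝔡-isIdeal Eⁿ∈𝔡 x+ω∈𝔡

  𝔢 : Elt → Set
  𝔢 = ⟨ E , x +ω⟩

  𝔢-isIdeal : IsIdeal m σ 𝔢
  𝔢-isIdeal = ⟨⟩-isIdeal x (∣-trans (i∣i^n E 1≤n) Eⁿ∣fx)

  𝔡≐𝔢ⁿ : 𝔡 ≐ Pow m σ 𝔢 n
  𝔡≐𝔢ⁿ = ≐-trans 𝔡≐⟨Eⁿ,x+ω⟩ (≐-sym (Pow-⟨⟩ n Eⁿ∣fx E⊥2x+σ))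

  𝔢-norm : HasNorm m σ 𝔢 e
  𝔢-norm = ⟨⟩-norm e x

lemma3 : (m σ : ℤ) → (σ ≡ + 0 ⊎ σ ≡ + 1) → IsFundamental (disc m σ) →
    (n : ℕ) → 2 ≤ n →
    (A₁ B₁ C₁ A₂ B₂ C₂ : ℤ) → InS m σ n A₁ B₁ C₁ → InS m σ n A₂ B₂ C₂ →
    let α₁ = (B₁ , C₁)
        α₂ = (B₂ , C₂)
        𝔡 = Gen₂ m σ α₁ (conj m σ α₂)
        g = gcd ∣ B₁ * B₂ + m * C₁ * C₂ ∣ ∣ B₁ * C₂ + B₂ * C₁ + σ * C₁ * C₂ ∣
    in (Σ (Elt → Set) λ 𝔢 → Σ ℕ λ e →
          IsIdeal m σ 𝔢 × (𝔡 ≐ Pow m σ 𝔢 n) × HasNorm m σ 𝔢 e × 0 < e × g ≡ e ^ n)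
     × ((e : ℕ) → 0 < e → g ≡ e ^ n →
          Σ (Elt → Set) λ 𝔢 → IsIdeal m σ 𝔢 × (𝔡 ≐ Pow m σ 𝔢 n) × HasNorm m σ 𝔢 e)
lemma3 m σ σ≡0,1 fundamental n 2≤n A₁ B₁ C₁ A₂ B₂ C₂ S₁ S₂ =
    (𝔢 , e , 𝔢-isIdeal , 𝔡≐𝔢ⁿ , 𝔢-norm , 0<e , g≡eⁿ)
  , λ e′ _ g≡e′ⁿ → 𝔢 , 𝔢-isIdeal , 𝔡≐𝔢ⁿ ,
      subst (HasNorm m σ 𝔢) (^-cancelʳ-≡ n 1≤n (trans (sym g≡eⁿ) g≡e′ⁿ)) 𝔢-norm
  where
  open TwoSolutions m σ σ≡0,1 fundamental n 2≤n A₁ B₁ C₁ A₂ B₂ C₂ S₁ S₂
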